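{- Let $Q$ be a finite connected poset, let $e\in Q$ be neither minimal nor maximal in $Q$, let $Q'=Q\setminus\{e\}$, $D=\{x\in Q: x<e\}$ and $U=\{x\in Q: x>e\}$, and let $X\subseteq\max(Q)$ and $Y\subseteq\min(Q)$ be such that $\{e\}$, $X$, $Y$ are pairwise parallel. Then \[ \varphi(Q,X,Y)=\varphi(Q'/U,X,Y)+\varphi(Q'/D,X,Y). \]
   Context: A subset of a poset is connected if it is non-empty and any two of its elements are joined by a sequence of its elements with consecutive elements comparable. $A\parallel B$ means every element of $A$ is incomparable to every element of $B$. For a poset $R$, $X\subseteq\max(R)$, $Y\subseteq\min(R)$: a filter $G\subseteq R$ (upward closed subset) is biconnected in $R$ if $G$ and $R\setminus G$ are both connected; it is an $(X,Y)$-filter in $R$ if $(R\setminus G)\cap\max(R)=X$ and $G\cap\min(R)=Y$; $\varphi(R,X,Y)$ is the number of biconnected $(X,Y)$-filters in $R$. Contraction: for a filter or order ideal $J$ of a poset $P$, $P/J$ is the poset whose elements are the classes $\{x\}$ for $x\in P\setminus J$ together with the class $J$ (if $J\neq\emptyset$), with $[x]\le[y]$ iff $x'\le y'$ for some $x'\in[x]$, $y'\in[y]$; elements outside $J$ are identified with their singleton classes. Here $U$ is a filter of $Q'$ and $D$ is an order ideal of $Q'$. Since $X$ and $Y$ are disjoint from $U\cup D$, they are regarded as sets of maximal, respectively minimal, elements of the contractions $Q'/U$ and $Q'/D$. -}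

module Defs where

open import Level using (0ℓ)
open import Data.Nat using (ℕ)
open import Data.Bool using (Bool; true; false; not; _∧_; T)
open import Data.Fin using (Fin)
open import Data.Fin.Properties using (_≟_)
open import Data.Maybe using (Maybe; just; nothing)
open import Data.Product using (Σ; ∃; ∃-syntax; _×_; _,_)
open import Data.Sum using (_⊎_)
open import Data.List using (List; length)
open import Data.List.Relation.Unary.All using (All)
open import Data.List.Relation.Unary.Any using (Any)
open import Data.List.Relation.Unary.AllPairs using (AllPairs)
open import Relation.Nullary using (¬_)
open import Relation.Nullary.Decidable using (⌊_⌋)
open import Relation.Binary using (Rel; IsPartialOrder; Decidable)
open import Relation.Binary.PropositionalEquality using (_≡_; _≢_)

module _ {C : Set} (_≤_ : C → C → Set) where

  Comparable : C → C → Set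
  Comparable x y = (x ≤ y) ⊎ (y ≤ x)

  IsMax : C → Set
  IsMax x = ∀ y → x ≤ y → y ≡ x

  IsMin : C → Set
  IsMin x = ∀ y → y ≤ x → y ≡ x

  data Chain (S : C → Bool) : C → C → Set where
    here : ∀ {x} → Chain S x x
    step : ∀ {x z y} → T (S z) → Comparable x z → Chain S z y → Chain S x y

  Connected : (C → Bool) → Set
  Connected S = (∃[ x ] T (S x)) ×
                (∀ x y → T (S x) → T (S y) → Chain S x y)

  IsFilter : (C → Bool) → Set
  IsFilter G = ∀ x y → x ≤ y → T (G x) → T (G y)

  Complement : (C → Bool) → (C → Bool)
  Complement G x = not (G x)

  Biconnected : (C → Bool) → Set
  Biconnected G = Connected G × Connected (Complement G)

  IsXYFilter : (X Y : C → Bool) → (C → Bool) → Set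
  IsXYFilter X Y G =
    IsFilter G ×
    (∀ x → ((T (Complement G x) × IsMax x) → T (X x)) ×
           (T (X x) → (T (Complement G x) × IsMax x))) ×
    (∀ x → ((T (G x) × IsMin x) → T (Y x)) ×
           (T (Y x) → (T (G x) × IsMin x)))

  BiconnectedXYFilter : (X Y : C → Bool) → (C → Bool) → Set
  BiconnectedXYFilter X Y G = IsXYFilter X Y G × Biconnected G

SameSubset : {C : Set} → (C → Bool) → (C → Bool) → Set
SameSubset s t = ∀ x → s x ≡ t x

CountIs : {C : Set} → ((C → Bool) → Set) → ℕ → Set
CountIs {C} P k =
  Σ (List (C → Bool)) λ l →
    (length l ≡ k) ×
    All P l ×
    AllPairs (λ s t → ¬ SameSubset s t) l ×
    (∀ s → P s → Any (SameSubset s) l)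

φ-is : {C : Set} (_≤_ : C → C → Set) (X Y : C → Bool) → ℕ → Set
φ-is _≤_ X Y k = CountIs (BiconnectedXYFilter _≤_ X Y) k

module Contraction {n : ℕ} (_≤_ : Rel (Fin n) 0ℓ) (_≤?_ : Decidable _≤_)
                   (e : Fin n) where

  _<_ : Fin n → Fin n → Set
  x < y = (x ≤ y) × (x ≢ y)

  isE : Fin n → Bool
  isE x = ⌊ x ≟ e ⌋

  U : Fin n → Bool
  U x = ⌊ e ≤? x ⌋ ∧ not (isE x)

  D : Fin n → Bool
  D x = ⌊ x ≤? e ⌋ ∧ not (isE x)

  -- Q'/J for J ∈ {U, D} (J ⊆ Q' = Q \ {e}):
  -- classes are `just (x , _)` = {x} for x ∈ Q' \ J, and `nothing` = the class J.
  Kept : (Fin n → Bool) → Fin n → Bool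
  Kept J x = not (isE x) ∧ not (J x)

  Elem : (Fin n → Bool) → Set
  Elem J = Maybe (Σ (Fin n) λ x → T (Kept J x))

  _∈cls_ : {J : Fin n → Bool} → Fin n → Elem J → Set
  _∈cls_ {J} x nothing = T (J x)
  _∈cls_ {J} x (just (y , _)) = y ≡ x

  _≤/_ : {J : Fin n → Bool} → Elem J → Elem J → Set
  _≤/_ {J} c d = ∃[ x ] ∃[ y ] (_∈cls_ {J} x c × _∈cls_ {J} y d × x ≤ y)

  -- a subset X of Q disjoint from J ∪ {e}, regarded as a subset of Q'/J
  lift : {J : Fin n → Bool} → (Fin n → Bool) → Elem J → Bool
  lift X nothing = false
  lift X (just (x , _)) = X x

{-# OPTIONS --safe #-}
-- Split the biconnected (X,Y)-filters G of Q according to whether e ∈ G.  If e ∈ G then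
-- U ⊆ G, and G is the pullback of a unique biconnected (X,Y)-filter of Q'/U along the map
-- Q → Q'/U collapsing U ∪ {e} to the class U; if e ∉ G then D ∩ G = ∅ and the same holds
-- for Q'/D.  The collapsing map is monotone and surjective, the order of the contraction is
-- the image of the order of Q, and every collapsed element is comparable with e, so chains,
-- filters and (where it matters) extremal elements are transported in both directions.
-- Conversely, the class U is maximal in Q'/U and not in X, so every biconnected
-- (X,Y)-filter of Q'/U contains it, and dually no such filter of Q'/D contains the class D.
module Submission where

open import Defs
open import Level using (0ℓ)
open import Function using (_∘_; id; _⇔_; mk⇔; Equivalence)
open import Function.Related.TypeIsomorphisms using (→-cong-⇔)
open import Data.Nat using (ℕ; _+_)
open import Data.Bool using (Bool; true; false; not; T)
open import Data.Bool.Properties using (T?; T-irrelevant; T-not-≡)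
open import Data.Empty using (⊥-elim)
open import Data.Fin using (Fin)
open import Data.Fin.Properties using (_≟_)
open import Data.Maybe using (just; nothing)
open import Data.Maybe.Properties using (just-injective)
open import Data.Product using (Σ; ∃-syntax; _×_; _,_; proj₁)
open import Data.Product.Function.NonDependent.Propositional using (_×-⇔_)
open import Data.Sum using (_⊎_; inj₁; inj₂; [_,_]′) renaming (map to ⊎-map; swap to ⊎-swap)
open import Data.List using (map; _++_)
open import Data.List.Properties using (length-++; length-map)
import Data.List.Relation.Unary.All as All
import Data.List.Relation.Unary.All.Properties as AllP
import Data.List.Relation.Unary.Any as Any
import Data.List.Relation.Unary.Any.Properties as AnyP
import Data.List.Relation.Unary.AllPairs as AllPairs
import Data.List.Relation.Unary.AllPairs.Properties as AllPairsP
open import Relation.Nullary using (¬_; Dec; yes; no; contradiction)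
open import Relation.Nullary.Decidable using (dec-true; dec-false)
open import Relation.Binary using (Rel; IsPartialOrder; Decidable)
open import Relation.Binary.PropositionalEquality
  using (_≡_; _≢_; refl; sym; trans; cong; subst; subst₂)

open Equivalence using (to; from)

T-cong : ∀ {a b} → a ≡ b → T a ⇔ T b
T-cong refl = mk⇔ id id

_++ᶜ_ : ∀ {C : Set} {_≤_ : C → C → Set} {S : C → Bool} {x y z : C} →
        Chain _≤_ S x y → Chain _≤_ S y z → Chain _≤_ S x z
here           ++ᶜ yz = yz
step Sw x~w wy ++ᶜ yz = step Sw x~w (wy ++ᶜ yz)

module _ {C : Set} {P : (C → Bool) → Set} where

  CountIs-split : (d : C) {a b : ℕ} →
                  CountIs (λ G → P G × T (G d)) a → CountIs (λ G → P G × ¬ T (G d)) b →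
                  CountIs P (a + b)
  CountIs-split d (l₁ , refl , P₁ , distinct₁ , complete₁)
                  (l₂ , refl , P₂ , distinct₂ , complete₂) =
    l₁ ++ l₂ , length-++ l₁ , AllP.++⁺ (All.map proj₁ P₁) (All.map proj₁ P₂) ,
    AllPairsP.++⁺ distinct₁ distinct₂ (All.map separated P₁) , complete
    where
    separated : ∀ {G} → P G × T (G d) → All.All (λ H → ¬ SameSubset G H) l₂
    separated (_ , Gd) = All.map (λ (_ , ¬Hd) G≈H → ¬Hd (subst T (G≈H d) Gd)) P₂

    complete : ∀ G → P G → Any.Any (SameSubset G) (l₁ ++ l₂)
    complete G PG with T? (G d)
    ... | yes Gd = AnyP.++⁺ˡ (complete₁ G (PG , Gd))
    ... | no ¬Gd = AnyP.++⁺ʳ l₁ (complete₂ G (PG , ¬Gd))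

module _ {A B : Set} (f : A → B) (r : B → A) (f∘r : ∀ c → f (r c) ≡ c) where

  SameSubset-pullback⁻ : {G H : B → Bool} → SameSubset (G ∘ f) (H ∘ f) → SameSubset G H
  SameSubset-pullback⁻ {G} {H} G∘f≈H∘f c = subst (λ c → G c ≡ H c) (f∘r c) (G∘f≈H∘f (r c))

  CountIs-pullback : {P : (A → Bool) → Set} {P′ : (B → Bool) → Set} {k : ℕ} →
                     (∀ G′ → P′ G′ → P (G′ ∘ f)) →
                     (∀ G → P G → Σ (B → Bool) λ G′ → P′ G′ × SameSubset G (G′ ∘ f)) →
                     CountIs P′ k → CountIs P k
  CountIs-pullback {P = P} pull descend (l , refl , P′l , distinct , complete) =
    map (_∘ f) l , length-map (_∘ f) l , AllP.gmap⁺ (pull _) P′l ,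
    AllPairsP.map⁺ (AllPairs.map (_∘ SameSubset-pullback⁻) distinct) , complete′
    where
    complete′ : ∀ G → P G → Any.Any (SameSubset G) (map (_∘ f) l)
    complete′ G PG with descend G PG
    ... | G′ , P′G′ , G≈G′∘f =
      AnyP.map⁺ (Any.map (λ G′≈H x → trans (G≈G′∘f x) (G′≈H (f x))) (complete G′ P′G′))

module QuotientMap {A B : Set} {_≤_ : A → A → Set} {_≤′_ : B → B → Set}
  (f : A → B) (rep : B → A) (f∘rep : ∀ c → f (rep c) ≡ c)
  (f-mono : ∀ {x y} → x ≤ y → f x ≤′ f y)
  (≤′-lift : ∀ {c d} → c ≤′ d → ∃[ x ] ∃[ y ] (f x ≡ c × f y ≡ d × x ≤ y))
  (comparable-rep : ∀ x → Comparable _≤_ x (rep (f x))) where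

  comparable-lift : ∀ {c d} → Comparable _≤′_ c d →
                    ∃[ x ] ∃[ y ] (f x ≡ c × f y ≡ d × Comparable _≤_ x y)
  comparable-lift (inj₁ c≤d) with ≤′-lift c≤d
  ... | x , y , fx≡c , fy≡d , x≤y = x , y , fx≡c , fy≡d , inj₁ x≤y
  comparable-lift (inj₂ d≤c) with ≤′-lift d≤c
  ... | y , x , fy≡d , fx≡c , y≤x = x , y , fx≡c , fy≡d , inj₂ y≤x

  module _ {S : A → Bool} {S′ : B → Bool} (coh : ∀ x → S x ≡ S′ (f x)) where

    T-coh : ∀ {x c} → f x ≡ c → T (S′ c) → T (S x)
    T-coh {x} refl = subst T (sym (coh x))

    fibre-chain : ∀ {x y} → f x ≡ f y → T (S x) → Chain _≤_ S x y
    fibre-chain {x} {y} fx≡fy Sx =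
      step (T-coh (f∘rep (f x)) S′fx) (comparable-rep x)
        (step (T-coh (sym fx≡fy) S′fx) rep~y here)
      where
      S′fx : T (S′ (f x))
      S′fx = subst T (coh x) Sx
      rep~y : Comparable _≤_ (rep (f x)) y
      rep~y = ⊎-swap (subst (Comparable _≤_ y ∘ rep) (sym fx≡fy) (comparable-rep y))

    chain-image : ∀ {x y} → Chain _≤_ S x y → Chain _≤′_ S′ (f x) (f y)
    chain-image here                     = here
    chain-image (step {z = z} Sz x~z zy) =
      step (subst T (coh z) Sz) (⊎-map f-mono f-mono x~z) (chain-image zy)

    chain-preimage : ∀ {c d x y} → Chain _≤′_ S′ c d → f x ≡ c → f y ≡ d → T (S x) →
                     Chain _≤_ S x y
    chain-preimage here fx≡c fy≡c Sx = fibre-chain (trans fx≡c (sym fy≡c)) Sx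
    chain-preimage (step S′w c~w wd) fx≡c fy≡d Sx with comparable-lift c~w
    ... | a , b , fa≡c , fb≡w , a~b =
      fibre-chain (trans fx≡c (sym fa≡c)) Sx ++ᶜ
      step (T-coh fb≡w S′w) a~b (chain-preimage wd fb≡w fy≡d (T-coh fb≡w S′w))

    connected⇔ : Connected _≤_ S ⇔ Connected _≤′_ S′
    connected⇔ = mk⇔ image preimage
      where
      image : Connected _≤_ S → Connected _≤′_ S′
      image ((x , Sx) , chains) = (f x , subst T (coh x) Sx) , λ c d S′c S′d →
        subst₂ (Chain _≤′_ S′) (f∘rep c) (f∘rep d)
          (chain-image (chains (rep c) (rep d) (T-coh (f∘rep c) S′c) (T-coh (f∘rep d) S′d)))

      preimage : Connected _≤′_ S′ → Connected _≤_ S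
      preimage ((c , S′c) , chains) = (rep c , T-coh (f∘rep c) S′c) , λ x y Sx Sy →
        chain-preimage (chains (f x) (f y) (subst T (coh x) Sx) (subst T (coh y) Sy)) refl refl Sx

    filter⇔ : IsFilter _≤_ S ⇔ IsFilter _≤′_ S′
    filter⇔ = mk⇔ image preimage
      where
      image : IsFilter _≤_ S → IsFilter _≤′_ S′
      image filter c d c≤d S′c with ≤′-lift c≤d
      ... | x , y , refl , refl , x≤y = subst T (coh y) (filter x y x≤y (T-coh refl S′c))

      preimage : IsFilter _≤′_ S′ → IsFilter _≤_ S
      preimage filter x y x≤y Sx = T-coh refl (filter (f x) (f y) (f-mono x≤y) (subst T (coh x) Sx))

  biconnected⇔ : {S : A → Bool} {S′ : B → Bool} → (∀ x → S x ≡ S′ (f x)) →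
                 Biconnected _≤_ S ⇔ Biconnected _≤′_ S′
  biconnected⇔ coh = connected⇔ coh ×-⇔ connected⇔ (cong not ∘ coh)

  module _ {x : A} (fibre-singleton : ∀ {y} → f y ≡ f x → y ≡ x) where

    IsMax⇔-singleton : IsMax _≤_ x ⇔ IsMax _≤′_ (f x)
    IsMax⇔-singleton = mk⇔ preserve reflect
      where
      preserve : IsMax _≤_ x → IsMax _≤′_ (f x)
      preserve max c fx≤c with ≤′-lift fx≤c
      ... | a , b , fa≡fx , refl , a≤b = cong f (max b (subst (_≤ b) (fibre-singleton fa≡fx) a≤b))

      reflect : IsMax _≤′_ (f x) → IsMax _≤_ x
      reflect max′ y x≤y = fibre-singleton (max′ (f y) (f-mono x≤y))

    IsMin⇔-singleton : IsMin _≤_ x ⇔ IsMin _≤′_ (f x)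
    IsMin⇔-singleton = mk⇔ preserve reflect
      where
      preserve : IsMin _≤_ x → IsMin _≤′_ (f x)
      preserve min c c≤fx with ≤′-lift c≤fx
      ... | a , b , refl , fb≡fx , a≤b = cong f (min a (subst (a ≤_) (fibre-singleton fb≡fx) a≤b))

      reflect : IsMin _≤′_ (f x) → IsMin _≤_ x
      reflect min′ y y≤x = fibre-singleton (min′ (f y) (f-mono y≤x))

  IsMax⇔-below : ∀ {x k} → x ≤ k → f x ≢ f k → IsMax _≤_ x ⇔ IsMax _≤′_ (f x)
  IsMax⇔-below x≤k fx≢fk =
    mk⇔ (λ max  → contradiction (cong f (sym (max _ x≤k))) fx≢fk)
        (λ max′ → contradiction (sym (max′ _ (f-mono x≤k))) fx≢fk)

  IsMin⇔-above : ∀ {x k} → k ≤ x → f k ≢ f x → IsMin _≤_ x ⇔ IsMin _≤′_ (f x)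
  IsMin⇔-above k≤x fk≢fx =
    mk⇔ (λ min  → contradiction (cong f (min _ k≤x)) fk≢fx)
        (λ min′ → contradiction (min′ _ (f-mono k≤x)) fk≢fx)

  ∀-surjection-⇔ : {C : A → Set} {C′ : B → Set} → (∀ x → C x ⇔ C′ (f x)) →
                   (∀ x → C x) ⇔ (∀ c → C′ c)
  ∀-surjection-⇔ {C′ = C′} C⇔C′ =
    mk⇔ (λ all c → subst C′ (f∘rep c) (to (C⇔C′ (rep c)) (all (rep c))))
        (λ all′ x → from (C⇔C′ x) (all′ (f x)))

  biconnectedXYFilter⇔ : {X Y G : A → Bool} {X′ Y′ G′ : B → Bool} →
    (∀ x → X x ≡ X′ (f x)) → (∀ x → Y x ≡ Y′ (f x)) → (∀ x → G x ≡ G′ (f x)) →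
    (∀ x → T (not (G x)) → IsMax _≤_ x ⇔ IsMax _≤′_ (f x)) →
    (∀ x → T (G x) → IsMin _≤_ x ⇔ IsMin _≤′_ (f x)) →
    BiconnectedXYFilter _≤_ X Y G ⇔ BiconnectedXYFilter _≤′_ X′ Y′ G′
  biconnectedXYFilter⇔ {G = G} {G′ = G′} X-coh Y-coh G-coh max⇔ min⇔ =
    (filter⇔ G-coh ×-⇔
     ∀-surjection-⇔ (λ x → characterises (outside x) (T-cong (X-coh x))) ×-⇔
     ∀-surjection-⇔ (λ x → characterises (inside x) (T-cong (Y-coh x))))
    ×-⇔ biconnected⇔ G-coh
    where
    characterises : ∀ {P P′ Q Q′ : Set} → P ⇔ P′ → Q ⇔ Q′ →
                    ((P → Q) × (Q → P)) ⇔ ((P′ → Q′) × (Q′ → P′))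
    characterises P⇔P′ Q⇔Q′ = →-cong-⇔ P⇔P′ Q⇔Q′ ×-⇔ →-cong-⇔ Q⇔Q′ P⇔P′

    outside : ∀ x → (T (not (G x)) × IsMax _≤_ x) ⇔ (T (not (G′ (f x))) × IsMax _≤′_ (f x))
    outside x = mk⇔ (λ (x∉G , max) → to ∉⇔ x∉G , to (max⇔ x x∉G) max)
                    (λ (fx∉G′ , max′) → from ∉⇔ fx∉G′ , from (max⇔ x (from ∉⇔ fx∉G′)) max′)
      where ∉⇔ = T-cong (cong not (G-coh x))

    inside : ∀ x → (T (G x) × IsMin _≤_ x) ⇔ (T (G′ (f x)) × IsMin _≤′_ (f x))
    inside x = mk⇔ (λ (x∈G , min) → to ∈⇔ x∈G , to (min⇔ x x∈G) min)
                   (λ (fx∈G′ , min′) → from ∈⇔ fx∈G′ , from (min⇔ x (from ∈⇔ fx∈G′)) min′)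
      where ∈⇔ = T-cong (G-coh x)

module Collapse {n : ℕ} {_≤_ : Rel (Fin n) 0ℓ} (po : IsPartialOrder _≡_ _≤_)
  (_≤?_ : Decidable _≤_) (e : Fin n) (J : Fin n → Bool)
  (J-nonempty : ∃[ j ] T (J j))
  (J-comparable : ∀ {j} → T (J j) → Comparable _≤_ j e)
  (above-e : ∀ {y} → e ≤ y → y ≢ e → ∃[ j ] (T (J j) × j ≤ y))
  (below-e : ∀ {x} → x ≤ e → x ≢ e → ∃[ j ] (T (J j) × x ≤ j)) where

  open Contraction _≤_ _≤?_ e
  open IsPartialOrder po using () renaming (refl to ≤-refl)

  _≤/J_ : Elem J → Elem J → Set
  _≤/J_ = _≤/_ {J}

  Merged : Fin n → Set
  Merged x = x ≡ e ⊎ T (J x)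

  merged-intro : ∀ {x} → (x ≢ e → T (J x)) → Merged x
  merged-intro {x} J-off-e with x ≟ e
  ... | yes x≡e = inj₁ x≡e
  ... | no x≢e  = inj₂ (J-off-e x≢e)

  merged-comparable : ∀ {x} → Merged x → Comparable _≤_ x e
  merged-comparable (inj₁ refl) = inj₁ ≤-refl
  merged-comparable (inj₂ Jx)   = J-comparable Jx

  kept-intro : ∀ {x} → x ≢ e → ¬ T (J x) → T (Kept J x)
  kept-intro {x} x≢e x∉J with x ≟ e | J x
  ... | yes x≡e | _     = ⊥-elim (x≢e x≡e)
  ... | no _    | true  = ⊥-elim (x∉J _)
  ... | no _    | false = _

  kept⇒¬merged : ∀ {x} → T (Kept J x) → ¬ Merged x
  kept⇒¬merged {x} kept merged with x ≟ e | J x | merged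
  ... | no x≢e | false | inj₁ x≡e = x≢e x≡e

  kept-or-merged : ∀ x → T (Kept J x) ⊎ Merged x
  kept-or-merged x = decide (x ≟ e) (T? (J x))
    where
    decide : Dec (x ≡ e) → Dec (T (J x)) → T (Kept J x) ⊎ Merged x
    decide (yes x≡e) _        = inj₂ (inj₁ x≡e)
    decide (no _)    (yes Jx) = inj₂ (inj₂ Jx)
    decide (no x≢e)  (no x∉J) = inj₁ (kept-intro x≢e x∉J)

  -- e is not an element of Q'/J; sending it to the class J is what makes collapse monotone.
  collapse : Fin n → Elem J
  collapse x with kept-or-merged x
  ... | inj₁ kept = just (x , kept)
  ... | inj₂ _    = nothing

  rep : Elem J → Fin n
  rep nothing        = e
  rep (just (x , _)) = x

  collapse-kept : ∀ {x} (kept : T (Kept J x)) → collapse x ≡ just (x , kept)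
  collapse-kept {x} kept with kept-or-merged x
  ... | inj₁ kept′  = cong (λ k → just (x , k)) (T-irrelevant kept′ kept)
  ... | inj₂ merged = ⊥-elim (kept⇒¬merged kept merged)

  collapse-merged : ∀ {x} → Merged x → collapse x ≡ nothing
  collapse-merged {x} merged with kept-or-merged x
  ... | inj₁ kept = ⊥-elim (kept⇒¬merged kept merged)
  ... | inj₂ _    = refl

  collapse-rep : ∀ c → collapse (rep c) ≡ c
  collapse-rep nothing           = collapse-merged (inj₁ refl)
  collapse-rep (just (_ , kept)) = collapse-kept kept

  kept≢merged : ∀ {k x} → T (Kept J k) → Merged x → collapse k ≢ collapse x
  kept≢merged kept merged k≡x
    with () ← trans (sym (collapse-kept kept)) (trans k≡x (collapse-merged merged))

  ∈cls⇒collapse : ∀ {x c} → _∈cls_ {J} x c → collapse x ≡ c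
  ∈cls⇒collapse {c = nothing}         Jx   = collapse-merged (inj₂ Jx)
  ∈cls⇒collapse {c = just (_ , kept)} refl = collapse-kept kept

  collapse-∈cls : ∀ {x} → x ≢ e → _∈cls_ {J} x (collapse x)
  collapse-∈cls {x} x≢e with kept-or-merged x
  ... | inj₁ _          = refl
  ... | inj₂ (inj₁ x≡e) = ⊥-elim (x≢e x≡e)
  ... | inj₂ (inj₂ Jx)  = Jx

  collapse-mono : ∀ {x y} → x ≤ y → collapse x ≤/J collapse y
  collapse-mono {x} {y} x≤y = go (x ≟ e) (y ≟ e)
    where
    J∈cls-e : ∀ {j} → T (J j) → _∈cls_ {J} j (collapse e)
    J∈cls-e Jj = subst (_∈cls_ _) (sym (collapse-merged (inj₁ refl))) Jj

    go : Dec (x ≡ e) → Dec (y ≡ e) → collapse x ≤/J collapse y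
    go (no x≢e) (no y≢e) = x , y , collapse-∈cls x≢e , collapse-∈cls y≢e , x≤y
    go (yes refl) (yes refl) =
      let j , Jj = J-nonempty in j , j , J∈cls-e Jj , J∈cls-e Jj , ≤-refl
    go (yes refl) (no y≢e) with above-e x≤y y≢e
    ... | j , Jj , j≤y = j , y , J∈cls-e Jj , collapse-∈cls y≢e , j≤y
    go (no x≢e) (yes refl) with below-e x≤y x≢e
    ... | j , Jj , x≤j = x , j , collapse-∈cls x≢e , J∈cls-e Jj , x≤j

  ≤/J-lift : ∀ {c d} → c ≤/J d → ∃[ x ] ∃[ y ] (collapse x ≡ c × collapse y ≡ d × x ≤ y)
  ≤/J-lift (x , y , x∈c , y∈d , x≤y) = x , y , ∈cls⇒collapse x∈c , ∈cls⇒collapse y∈d , x≤y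

  comparable-rep : ∀ x → Comparable _≤_ x (rep (collapse x))
  comparable-rep x with kept-or-merged x
  ... | inj₁ _      = inj₁ ≤-refl
  ... | inj₂ merged = merged-comparable merged

  open QuotientMap collapse rep collapse-rep collapse-mono ≤/J-lift comparable-rep public

  kept-singleton : ∀ {x y} → T (Kept J x) → collapse y ≡ collapse x → y ≡ x
  kept-singleton {x} {y} kept fy≡fx = [ from-kept , from-merged ]′ (kept-or-merged y)
    where
    from-kept : T (Kept J y) → y ≡ x
    from-kept kept′ = cong proj₁ (just-injective
      (trans (sym (collapse-kept kept′)) (trans fy≡fx (collapse-kept kept))))

    from-merged : Merged y → y ≡ x
    from-merged merged = contradiction (sym fy≡fx) (kept≢merged kept merged)

  IsMax⇔-kept : ∀ {x} → T (Kept J x) → IsMax _≤_ x ⇔ IsMax _≤/J_ (collapse x)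
  IsMax⇔-kept kept = IsMax⇔-singleton (kept-singleton kept)

  IsMin⇔-kept : ∀ {x} → T (Kept J x) → IsMin _≤_ x ⇔ IsMin _≤/J_ (collapse x)
  IsMin⇔-kept kept = IsMin⇔-singleton (kept-singleton kept)

  IsMax-class : (∀ {j y} → T (J j) → j ≤ y → Merged y) → IsMax _≤/J_ nothing
  IsMax-class _    nothing           _                         = refl
  IsMax-class J-up (just (y , kept)) (j , _ , Jj , refl , j≤y) =
    ⊥-elim (kept⇒¬merged kept (J-up Jj j≤y))

  IsMin-class : (∀ {j x} → T (J j) → x ≤ j → Merged x) → IsMin _≤/J_ nothing
  IsMin-class _      nothing           _                         = refl
  IsMin-class J-down (just (x , kept)) (_ , j , refl , Jj , x≤j) =
    ⊥-elim (kept⇒¬merged kept (J-down Jj x≤j))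

  lift-collapse : {X : Fin n → Bool} → (∀ x → T (X x) → ¬ Comparable _≤_ e x) →
                  ∀ x → X x ≡ lift X (collapse x)
  lift-collapse {X} X∥e x with kept-or-merged x
  ... | inj₁ _      = refl
  ... | inj₂ merged = dec-false (T? (X x)) (λ Xx → X∥e x Xx (⊎-swap (merged-comparable merged)))

  collapse-coh : {G : Fin n → Bool} → (∀ {j} → T (J j) → G j ≡ G e) →
                 ∀ x → G x ≡ G (rep (collapse x))
  collapse-coh G-J x with kept-or-merged x
  ... | inj₁ _           = refl
  ... | inj₂ (inj₁ refl) = refl
  ... | inj₂ (inj₂ Jx)   = G-J Jx

module _ {n : ℕ} {_≤_ : Rel (Fin n) 0ℓ} (_≤?_ : Decidable _≤_) (e : Fin n) where
  open Contraction _≤_ _≤?_ e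

  U-intro : ∀ {x} → e ≤ x → x ≢ e → T (U x)
  U-intro {x} e≤x x≢e with e ≤? x | x ≟ e
  ... | no e≰x | _        = e≰x e≤x
  ... | yes _  | yes x≡e  = x≢e x≡e
  ... | yes _  | no _     = _

  U⇒e≤ : ∀ {x} → T (U x) → e ≤ x
  U⇒e≤ {x} Ux with e ≤? x
  ... | yes e≤x = e≤x

  D-intro : ∀ {x} → x ≤ e → x ≢ e → T (D x)
  D-intro {x} x≤e x≢e with x ≤? e | x ≟ e
  ... | no x≰e | _        = x≰e x≤e
  ... | yes _  | yes x≡e  = x≢e x≡e
  ... | yes _  | no _     = _

  D⇒≤e : ∀ {x} → T (D x) → x ≤ e
  D⇒≤e {x} Dx with x ≤? e
  ... | yes x≤e = x≤e

module UpperContraction {n : ℕ} {_≤_ : Rel (Fin n) 0ℓ} (po : IsPartialOrder _≡_ _≤_)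
  (_≤?_ : Decidable _≤_) {e d u : Fin n} (d≤e : d ≤ e) (d≢e : d ≢ e) (e≤u : e ≤ u) (e≢u : e ≢ u)
  {X Y : Fin n → Bool}
  (X∥e : ∀ x → T (X x) → ¬ Comparable _≤_ e x) (Y∥e : ∀ y → T (Y y) → ¬ Comparable _≤_ e y) where

  open Contraction _≤_ _≤?_ e using (U; Kept; Elem; lift)
  open IsPartialOrder po using (antisym) renaming (refl to ≤-refl; trans to ≤-trans)

  Uu : T (U u)
  Uu = U-intro _≤?_ e e≤u (e≢u ∘ sym)

  open Collapse po _≤?_ e U (u , Uu) (inj₂ ∘ U⇒e≤ _≤?_ e)
    (λ e≤y y≢e → _ , U-intro _≤?_ e e≤y y≢e , ≤-refl) (λ x≤e _ → u , Uu , ≤-trans x≤e e≤u)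

  d-kept : T (Kept U d)
  d-kept = kept-intro d≢e (λ Ud → d≢e (antisym d≤e (U⇒e≤ _≤?_ e Ud)))

  d-below-merged : ∀ {x} → Merged x → d ≤ x
  d-below-merged (inj₁ refl) = d≤e
  d-below-merged (inj₂ Ux)   = ≤-trans d≤e (U⇒e≤ _≤?_ e Ux)

  U-up : ∀ {j y} → T (U j) → j ≤ y → Merged y
  U-up Uj j≤y = merged-intro (U-intro _≤?_ e (≤-trans (U⇒e≤ _≤?_ e Uj) j≤y))

  IsMin⇔ : ∀ x → IsMin _≤_ x ⇔ IsMin _≤/J_ (collapse x)
  IsMin⇔ x = [ IsMin⇔-kept , below-d ]′ (kept-or-merged x)
    where
    below-d : Merged x → IsMin _≤_ x ⇔ IsMin _≤/J_ (collapse x)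
    below-d merged = IsMin⇔-above (d-below-merged merged) (kept≢merged d-kept merged)

  IsMax⇔-outside : {G : Fin n → Bool} → (∀ {x} → Merged x → T (G x)) →
                   ∀ x → T (not (G x)) → IsMax _≤_ x ⇔ IsMax _≤/J_ (collapse x)
  IsMax⇔-outside G-merged x x∉G =
    [ IsMax⇔-kept , (λ merged → ⊥-elim (subst T (to T-not-≡ x∉G) (G-merged merged))) ]′
      (kept-or-merged x)

  BXYFilter : (Fin n → Bool) → Set
  BXYFilter = BiconnectedXYFilter _≤_ X Y

  BXYFilter/U : (Elem U → Bool) → Set
  BXYFilter/U = BiconnectedXYFilter _≤/J_ (lift X) (lift Y)

  class-in-filter : ∀ {G′} → BXYFilter/U G′ → T (G′ nothing)
  class-in-filter {G′} ((_ , X-cond , _) , _) with T? (G′ nothing)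
  ... | yes inside = inside
  ... | no outside =
    ⊥-elim (proj₁ (X-cond nothing) (from T-not-≡ (dec-false (T? _) outside) , IsMax-class U-up))

  pullback : ∀ G′ → BXYFilter/U G′ → BXYFilter (G′ ∘ collapse) × T (G′ (collapse e))
  pullback G′ bxy =
    from (biconnectedXYFilter⇔ (lift-collapse X∥e) (lift-collapse Y∥e) (λ _ → refl)
                               (IsMax⇔-outside merged-in) (λ x _ → IsMin⇔ x)) bxy ,
    merged-in (inj₁ refl)
    where
    merged-in : ∀ {x} → Merged x → T (G′ (collapse x))
    merged-in merged = subst (T ∘ G′) (sym (collapse-merged merged)) (class-in-filter bxy)

  descend : ∀ G → BXYFilter G × T (G e) →
            Σ (Elem U → Bool) λ G′ → BXYFilter/U G′ × SameSubset G (G′ ∘ collapse)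
  descend G (bxy@((filter , _) , _) , Ge) =
    G ∘ rep ,
    to (biconnectedXYFilter⇔ (lift-collapse X∥e) (lift-collapse Y∥e) coh
                             (IsMax⇔-outside merged-in) (λ x _ → IsMin⇔ x)) bxy ,
    coh
    where
    merged-in : ∀ {x} → Merged x → T (G x)
    merged-in (inj₁ refl) = Ge
    merged-in (inj₂ Ux)   = filter e _ (U⇒e≤ _≤?_ e Ux) Ge

    coh : ∀ x → G x ≡ G (rep (collapse x))
    coh = collapse-coh λ Uj →
      trans (dec-true (T? _) (merged-in (inj₂ Uj))) (sym (dec-true (T? _) Ge))

  count : ∀ {k} → CountIs BXYFilter/U k → CountIs (λ G → BXYFilter G × T (G e)) k
  count = CountIs-pullback collapse rep collapse-rep pullback descend

module LowerContraction {n : ℕ} {_≤_ : Rel (Fin n) 0ℓ} (po : IsPartialOrder _≡_ _≤_)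
  (_≤?_ : Decidable _≤_) {e d u : Fin n} (d≤e : d ≤ e) (d≢e : d ≢ e) (e≤u : e ≤ u) (e≢u : e ≢ u)
  {X Y : Fin n → Bool}
  (X∥e : ∀ x → T (X x) → ¬ Comparable _≤_ e x) (Y∥e : ∀ y → T (Y y) → ¬ Comparable _≤_ e y) where

  open Contraction _≤_ _≤?_ e using (D; Kept; Elem; lift)
  open IsPartialOrder po using (antisym) renaming (refl to ≤-refl; trans to ≤-trans)

  Dd : T (D d)
  Dd = D-intro _≤?_ e d≤e d≢e

  open Collapse po _≤?_ e D (d , Dd) (inj₁ ∘ D⇒≤e _≤?_ e)
    (λ e≤y _ → d , Dd , ≤-trans d≤e e≤y) (λ x≤e x≢e → _ , D-intro _≤?_ e x≤e x≢e , ≤-refl)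

  u-kept : T (Kept D u)
  u-kept = kept-intro (e≢u ∘ sym) (λ Du → e≢u (antisym e≤u (D⇒≤e _≤?_ e Du)))

  merged-below-u : ∀ {x} → Merged x → x ≤ u
  merged-below-u (inj₁ refl) = e≤u
  merged-below-u (inj₂ Dx)   = ≤-trans (D⇒≤e _≤?_ e Dx) e≤u

  D-down : ∀ {j x} → T (D j) → x ≤ j → Merged x
  D-down Dj x≤j = merged-intro (D-intro _≤?_ e (≤-trans x≤j (D⇒≤e _≤?_ e Dj)))

  IsMax⇔ : ∀ x → IsMax _≤_ x ⇔ IsMax _≤/J_ (collapse x)
  IsMax⇔ x = [ IsMax⇔-kept , below-u ]′ (kept-or-merged x)
    where
    below-u : Merged x → IsMax _≤_ x ⇔ IsMax _≤/J_ (collapse x)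
    below-u merged = IsMax⇔-below (merged-below-u merged) (kept≢merged u-kept merged ∘ sym)

  IsMin⇔-inside : {G : Fin n → Bool} → (∀ {x} → Merged x → ¬ T (G x)) →
                  ∀ x → T (G x) → IsMin _≤_ x ⇔ IsMin _≤/J_ (collapse x)
  IsMin⇔-inside G-merged x x∈G =
    [ IsMin⇔-kept , (λ merged → ⊥-elim (G-merged merged x∈G)) ]′ (kept-or-merged x)

  BXYFilter : (Fin n → Bool) → Set
  BXYFilter = BiconnectedXYFilter _≤_ X Y

  BXYFilter/D : (Elem D → Bool) → Set
  BXYFilter/D = BiconnectedXYFilter _≤/J_ (lift X) (lift Y)

  class-not-in-filter : ∀ {G′} → BXYFilter/D G′ → ¬ T (G′ nothing)
  class-not-in-filter ((_ , _ , Y-cond) , _) inside =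
    proj₁ (Y-cond nothing) (inside , IsMin-class D-down)

  pullback : ∀ G′ → BXYFilter/D G′ → BXYFilter (G′ ∘ collapse) × ¬ T (G′ (collapse e))
  pullback G′ bxy =
    from (biconnectedXYFilter⇔ (lift-collapse X∥e) (lift-collapse Y∥e) (λ _ → refl)
                               (λ x _ → IsMax⇔ x) (IsMin⇔-inside merged-out)) bxy ,
    merged-out (inj₁ refl)
    where
    merged-out : ∀ {x} → Merged x → ¬ T (G′ (collapse x))
    merged-out merged = class-not-in-filter bxy ∘ subst (T ∘ G′) (collapse-merged merged)

  descend : ∀ G → BXYFilter G × ¬ T (G e) →
            Σ (Elem D → Bool) λ G′ → BXYFilter/D G′ × SameSubset G (G′ ∘ collapse)
  descend G (bxy@((filter , _) , _) , e∉G) =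
    G ∘ rep ,
    to (biconnectedXYFilter⇔ (lift-collapse X∥e) (lift-collapse Y∥e) coh
                             (λ x _ → IsMax⇔ x) (IsMin⇔-inside merged-out)) bxy ,
    coh
    where
    merged-out : ∀ {x} → Merged x → ¬ T (G x)
    merged-out (inj₁ refl) = e∉G
    merged-out (inj₂ Dx)   = e∉G ∘ filter _ e (D⇒≤e _≤?_ e Dx)

    coh : ∀ x → G x ≡ G (rep (collapse x))
    coh = collapse-coh λ Dj →
      trans (dec-false (T? _) (merged-out (inj₂ Dj))) (sym (dec-false (T? _) e∉G))

  count : ∀ {k} → CountIs BXYFilter/D k → CountIs (λ G → BXYFilter G × ¬ T (G e)) k
  count = CountIs-pullback collapse rep collapse-rep pullback descend

lemma4p11 : (n : ℕ) (_≤_ : Rel (Fin n) 0ℓ) → IsPartialOrder _≡_ _≤_ → (_≤?_ : Decidable _≤_) →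
    Connected _≤_ (λ _ → true) →
    (e : Fin n) →
    (∃[ x ] Contraction._<_ _≤_ _≤?_ e x e) →
    (∃[ x ] Contraction._<_ _≤_ _≤?_ e e x) →
    (X Y : Fin n → Bool) →
    (∀ x → T (X x) → IsMax _≤_ x) →
    (∀ y → T (Y y) → IsMin _≤_ y) →
    (∀ x → T (X x) → ¬ Comparable _≤_ e x) →
    (∀ y → T (Y y) → ¬ Comparable _≤_ e y) →
    (∀ x y → T (X x) → T (Y y) → ¬ Comparable _≤_ x y) →
    (a b : ℕ) →
    φ-is (Contraction._≤/_ _≤_ _≤?_ e {Contraction.U _≤_ _≤?_ e})
      (Contraction.lift _≤_ _≤?_ e X) (Contraction.lift _≤_ _≤?_ e Y) a →
    φ-is (Contraction._≤/_ _≤_ _≤?_ e {Contraction.D _≤_ _≤?_ e})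
      (Contraction.lift _≤_ _≤?_ e X) (Contraction.lift _≤_ _≤?_ e Y) b →
    φ-is _≤_ X Y (a + b)
lemma4p11 n _≤_ po _≤?_ _ e (d , d≤e , d≢e) (u , e≤u , e≢u) X Y _ _ X∥e Y∥e _ a b φ/U φ/D =
  CountIs-split e (Upper.count φ/U) (Lower.count φ/D)
  where
  module Upper = UpperContraction po _≤?_ d≤e d≢e e≤u e≢u X∥e Y∥e
  module Lower = LowerContraction po _≤?_ d≤e d≢e e≤u e≢u X∥e Y∥e
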